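{- Let $G=(V,E)$ and $G'=(V',E')$ be isomorphic directed graphs. If $\sigma=(\mathcal O,R,f)$ is a skeleton over $V$ and $\tau=(\mathcal P,Q,g)$ is a skeleton over $V'$ such that $G=G_\sigma$ and $G'=G_\tau$, then $\sigma$ and $\tau$ are companions.
   Context: A directed graph $G=(V,E)$ has finite vertex set $V$ and $E\subseteq V\times V$. A skeleton over a finite set $V$ is a triple $\sigma=(\mathcal O,R,f)$ where $R\subseteq V$, $\mathcal O=\{O_z\mid z\in R\}$ is a family of subsets of $V$ indexed by $R$ with $O_z=O_{z'}$ iff $z=z'$ and $|\mathcal O|\le|V|$, and $f:V\to R$ is a surjection. The graph defined by $\sigma$ is $G_\sigma=(V,E)$ with $E=\{(x,w)\mid x\in V,\ w\in O_{f(x)}\}$. For a family $\mathcal O$, $\mathcal O^\cap$ is the smallest family containing $\mathcal O$ and closed under intersection of two sets. A faithful correspondence between $\mathcal O\subseteq 2^V$ and $\mathcal P\subseteq 2^W$ is a bijection $\eta:\mathcal O^\cap\to\mathcal P^\cap$ with $|X|=|\eta(X)|$ and $\eta(X\cap Y)=\eta(X)\cap\eta(Y)$ for all $X,Y\in\mathcal O^\cap$. Skeletons $\sigma=(\mathcal O,R,f)$ over $V$ and $\tau=(\mathcal P,Q,g)$ over $W$ are companions if there is a bijection $\eta:V\to W$ whose elementwise extension to subsets restricts to a faithful correspondence $\mathcal O^\cap\to\mathcal P^\cap$ and satisfies $\eta(O_{f(x)})=P_{g(\eta(x))}$ for all $x\in V$. -}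

module Defs where

open import Data.Nat using (ℕ)
open import Data.Bool using (Bool)
open import Data.Fin using (Fin)
open import Data.Fin.Subset using (Subset; _∈_; _∩_; ∣_∣)
open import Data.Vec using (lookup; tabulate)
open import Data.Product using (Σ; ∃; _×_; _,_)
open import Function.Bundles using (_↔_; Inverse)
open import Relation.Binary.PropositionalEquality using (_≡_)

Graph : ℕ → Set
Graph n = Fin n → Fin n → Bool

_≐_ : ∀ {n} → Graph n → Graph n → Set
E ≐ E' = ∀ x w → E x w ≡ E' x w

record GraphIso {n m : ℕ} (E : Graph n) (E' : Graph m) : Set where
  field
    φ        : Fin n ↔ Fin m
    preserve : ∀ x y → E x y ≡ E' (Inverse.to φ x) (Inverse.to φ y)

-- R ⊆ V is a subset; the family 𝒪 = {O_z | z ∈ R} is given by a function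
-- O : Fin n → Subset n whose values are only relevant on R;
-- f : V → R is a surjection (values of f lie in R, every z ∈ R is hit).
-- The condition |𝒪| ≤ |V| is automatic, since 𝒪 is indexed by R ⊆ V.
record Skeleton (n : ℕ) : Set where
  field
    R      : Subset n
    O      : Fin n → Subset n
    O-inj  : ∀ z z' → z ∈ R → z' ∈ R → O z ≡ O z' → z ≡ z'
    f      : Fin n → Fin n
    f-in-R : ∀ x → f x ∈ R
    f-surj : ∀ z → z ∈ R → ∃ λ x → f x ≡ z

graphOf : ∀ {n} → Skeleton n → Graph n
graphOf σ x w = lookup (Skeleton.O σ (Skeleton.f σ x)) w
  where open Skeleton

data InCap {n : ℕ} (σ : Skeleton n) : Subset n → Set where
  base  : ∀ z → z ∈ Skeleton.R σ → InCap σ (Skeleton.O σ z)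
  inter : ∀ {X Y} → InCap σ X → InCap σ Y → InCap σ (X ∩ Y)

-- Elementwise extension of a bijection V → W to subsets: η(X) = {η x | x ∈ X}.
image : ∀ {n m} → Fin n ↔ Fin m → Subset n → Subset m
image η X = tabulate (λ w → lookup X (Inverse.from η w))

record FaithfulCorr {n m : ℕ} (σ : Skeleton n) (τ : Skeleton m)
                    (h : Subset n → Subset m) : Set where
  field
    into   : ∀ X → InCap σ X → InCap τ (h X)
    inj    : ∀ X Y → InCap σ X → InCap σ Y → h X ≡ h Y → X ≡ Y
    surj   : ∀ Y → InCap τ Y → Σ (Subset n) λ X → InCap σ X × h X ≡ Y
    card   : ∀ X → InCap σ X → ∣ X ∣ ≡ ∣ h X ∣
    pres-∩ : ∀ X Y → InCap σ X → InCap σ Y → h (X ∩ Y) ≡ h X ∩ h Y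

Companions : ∀ {n m} → Skeleton n → Skeleton m → Set
Companions {n} {m} σ τ =
  Σ (Fin n ↔ Fin m) λ η →
    FaithfulCorr σ τ (image η) ×
    (∀ x → image η (Skeleton.O σ (Skeleton.f σ x))
           ≡ Skeleton.O τ (Skeleton.f τ (Inverse.to η x)))

module Submission where

-- Let φ : V ≅ V' be an isomorphism G_σ ≅ G_τ.  The out-neighbourhood
-- of x in G_σ is O_{f(x)}, and φ carries out-neighbourhoods of G onto
-- out-neighbourhoods of G'; hence φ(O_{f(x)}) = P_{g(φ x)} for every x.
-- Since f and g are surjective onto the index sets, φ therefore maps the
-- generators of 𝒪^∩ onto the generators of 𝒫^∩, and as the elementwise image
-- of a bijection commutes with ∩, is injective and preserves cardinality,
-- it restricts to a faithful correspondence 𝒪^∩ → 𝒫^∩.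

open import Defs
open import Data.Nat using (ℕ; suc)
open import Data.Nat.Properties using (+-0-commutativeMonoid)
open import Data.Bool using (Bool; true; false; _∧_)
open import Data.Fin using (Fin)
open import Data.Fin.Subset using (Subset; _∩_; ∣_∣)
open import Data.Fin.Permutation using (inverseˡ; inverseʳ; flip; _⟨$⟩ʳ_)
open import Data.Vec using (Vec; []; _∷_; lookup; tabulate)
open import Data.Vec.Properties
  using (lookup∘tabulate; tabulate∘lookup; tabulate-cong; lookup-zipWith)
open import Data.Product using (Σ; ∃; _×_; _,_)
open import Function.Bundles using (_↔_; Inverse)
open import Relation.Binary.PropositionalEquality
open import Algebra.Properties.CommutativeMonoid.Sum +-0-commutativeMonoid
  using (sum; sum-permute; sum-cong-≗)

lookup-ext : ∀ {A : Set} {n} (xs ys : Vec A n) →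
             (∀ i → lookup xs i ≡ lookup ys i) → xs ≡ ys
lookup-ext xs ys same = begin
  xs                    ≡⟨ tabulate∘lookup xs ⟨
  tabulate (lookup xs)  ≡⟨ tabulate-cong same ⟩
  tabulate (lookup ys)  ≡⟨ tabulate∘lookup ys ⟩
  ys                    ∎
  where open ≡-Reasoning

indicator : Bool → ℕ
indicator true  = 1
indicator false = 0

card-as-sum : ∀ {n} (X : Subset n) → ∣ X ∣ ≡ sum (λ i → indicator (lookup X i))
card-as-sum []          = refl
card-as-sum (true ∷ X)  = cong suc (card-as-sum X)
card-as-sum (false ∷ X) = card-as-sum X

module Image {n m : ℕ} (η : Fin n ↔ Fin m) where
  private
    to   = Inverse.to η
    from = Inverse.from η

  lookup-image : ∀ X w → lookup (image η X) w ≡ lookup X (from w)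
  lookup-image X w = lookup∘tabulate _ w

  lookup-image-to : ∀ X x → lookup (image η X) (to x) ≡ lookup X x
  lookup-image-to X x = trans (lookup-image X (to x)) (cong (lookup X) (inverseˡ η))

  image-injective : ∀ X Y → image η X ≡ image η Y → X ≡ Y
  image-injective X Y eq = lookup-ext X Y λ x → begin
    lookup X x                 ≡⟨ lookup-image-to X x ⟨
    lookup (image η X) (to x)  ≡⟨ cong (λ Z → lookup Z (to x)) eq ⟩
    lookup (image η Y) (to x)  ≡⟨ lookup-image-to Y x ⟩
    lookup Y x                 ∎
    where open ≡-Reasoning

  image-∩ : ∀ X Y → image η (X ∩ Y) ≡ image η X ∩ image η Y
  image-∩ X Y = lookup-ext _ _ λ w → begin
    lookup (image η (X ∩ Y)) w                   ≡⟨ lookup-image (X ∩ Y) w ⟩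
    lookup (X ∩ Y) (from w)                      ≡⟨ lookup-zipWith _∧_ (from w) X Y ⟩
    lookup X (from w) ∧ lookup Y (from w)        ≡⟨ cong₂ _∧_ (lookup-image X w) (lookup-image Y w) ⟨
    lookup (image η X) w ∧ lookup (image η Y) w  ≡⟨ lookup-zipWith _∧_ w (image η X) (image η Y) ⟨
    lookup (image η X ∩ image η Y) w             ∎
    where open ≡-Reasoning

  -- |η(X)| = |X|: reindex the sum of indicators along the bijection.
  image-card : ∀ X → ∣ X ∣ ≡ ∣ image η X ∣
  image-card X = begin
    ∣ X ∣                                          ≡⟨ card-as-sum X ⟩
    sum (λ i → indicator (lookup X i))             ≡⟨ sum-permute _ (flip η) ⟩
    sum (λ w → indicator (lookup X (flip η ⟨$⟩ʳ w))) ≡⟨ sum-cong-≗ (λ w → cong indicator (lookup-image X w)) ⟨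
    sum (λ w → indicator (lookup (image η X) w))   ≡⟨ card-as-sum (image η X) ⟨
    ∣ image η X ∣                                  ∎
    where open ≡-Reasoning

-- 2. Intersection closures.  By surjectivity of f, the generators of 𝒪^∩
-- are exactly the sets O_{f(x)}, so maps commuting with ∩ are controlled by
-- their values on these sets.
module Closure {n m : ℕ} (σ : Skeleton n) (τ : Skeleton m)
               (h : Subset n → Subset m)
               (h-∩ : ∀ X Y → h (X ∩ Y) ≡ h X ∩ h Y) where
  private
    module S = Skeleton σ
    module T = Skeleton τ

  map-into : (∀ x → InCap τ (h (S.O (S.f x)))) →
             ∀ X → InCap σ X → InCap τ (h X)
  map-into gen _ (base z z∈R) with S.f-surj z z∈R
  ... | x , refl = gen x
  map-into gen _ (inter {X} {Y} p q) =
    subst (InCap τ) (sym (h-∩ X Y)) (inter (map-into gen X p) (map-into gen Y q))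

  map-onto : (∀ y → ∃ λ x → h (S.O (S.f x)) ≡ T.O (T.f y)) →
             ∀ Y → InCap τ Y → Σ (Subset n) λ X → InCap σ X × h X ≡ Y
  map-onto gen _ (base z z∈R) with T.f-surj z z∈R
  ... | y , refl with gen y
  ...   | x , hx≡ = S.O (S.f x) , base (S.f x) (S.f-in-R x) , hx≡
  map-onto gen _ (inter p q) with map-onto gen _ p | map-onto gen _ q
  ... | X , pX , refl | Y , pY , refl = X ∩ Y , inter pX pY , h-∩ X Y

companions-from-transport :
  ∀ {n m} (σ : Skeleton n) (τ : Skeleton m) (η : Fin n ↔ Fin m) →
  (∀ x → image η (Skeleton.O σ (Skeleton.f σ x))
         ≡ Skeleton.O τ (Skeleton.f τ (Inverse.to η x))) →
  Companions σ τ
companions-from-transport σ τ η transport = η , faithful , transport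
  where
  module S = Skeleton σ
  module T = Skeleton τ
  open Inverse η using (to; from)
  open Image η
  open Closure σ τ (image η) image-∩

  generators-into : ∀ x → InCap τ (image η (S.O (S.f x)))
  generators-into x =
    subst (InCap τ) (sym (transport x)) (base (T.f (to x)) (T.f-in-R (to x)))

  generators-onto : ∀ y → ∃ λ x → image η (S.O (S.f x)) ≡ T.O (T.f y)
  generators-onto y =
    from y , trans (transport (from y)) (cong (λ v → T.O (T.f v)) (inverseʳ η))

  faithful : FaithfulCorr σ τ (image η)
  faithful = record
    { into   = map-into generators-into
    ; inj    = λ X Y _ _ → image-injective X Y
    ; surj   = map-onto generators-onto
    ; card   = λ X _ → image-card X
    ; pres-∩ = λ X Y _ _ → image-∩ X Y
    }

neighbours : ∀ {n} → Graph n → Fin n → Subset n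
neighbours E x = tabulate (E x)

neighbours-of-skeleton : ∀ {n} {G : Graph n} (σ : Skeleton n) → G ≐ graphOf σ →
  ∀ x → neighbours G x ≡ Skeleton.O σ (Skeleton.f σ x)
neighbours-of-skeleton σ G≐Gσ x =
  trans (tabulate-cong (G≐Gσ x)) (tabulate∘lookup (Skeleton.O σ (Skeleton.f σ x)))

image-neighbours : ∀ {n m} {G : Graph n} {G' : Graph m} (iso : GraphIso G G') →
  let φ = GraphIso.φ iso in
  ∀ x → image φ (neighbours G x) ≡ neighbours G' (Inverse.to φ x)
image-neighbours {G = G} {G'} iso x = tabulate-cong λ w → begin
  lookup (tabulate (G x)) (from w)  ≡⟨ lookup∘tabulate (G x) (from w) ⟩
  G x (from w)                      ≡⟨ preserve x (from w) ⟩
  G' (to x) (to (from w))           ≡⟨ cong (G' (to x)) (inverseʳ φ) ⟩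
  G' (to x) w                       ∎
  where
  open GraphIso iso
  open Inverse φ using (to; from)
  open ≡-Reasoning

corollary3p10 : (n m : ℕ) (G : Graph n) (G' : Graph m) →
    GraphIso G G' →
    (σ : Skeleton n) (τ : Skeleton m) →
    G ≐ graphOf σ → G' ≐ graphOf τ →
    Companions σ τ
corollary3p10 n m G G' iso σ τ G≐Gσ G'≐Gτ = companions-from-transport σ τ φ transport
  where
  open GraphIso iso using (φ)
  open Inverse φ using (to)
  module S = Skeleton σ
  module T = Skeleton τ

  transport : ∀ x → image φ (S.O (S.f x)) ≡ T.O (T.f (to x))
  transport x = begin
    image φ (S.O (S.f x))     ≡⟨ cong (image φ) (neighbours-of-skeleton σ G≐Gσ x) ⟨
    image φ (neighbours G x)  ≡⟨ image-neighbours iso x ⟩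
    neighbours G' (to x)      ≡⟨ neighbours-of-skeleton τ G'≐Gτ (to x) ⟩
    T.O (T.f (to x))          ∎
    where open ≡-Reasoning
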